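{- For any string $S$, $|\mathcal{PS}_S| \leq 2|S| - |\mathcal{M}_S|$.
   Context: For a string $S$ of length $n$ and $1 \le i \le j \le n$, $S[i..j]$ is the substring from position $i$ to position $j$, and $\#\mathit{occ}_S(w)$ is the number of positions $i$ with $S[i..i+|w|-1]=w$. A non-empty substring $w$ is unique if $\#\mathit{occ}_S(w)=1$ and repeating if $\#\mathit{occ}_S(w)\ge 2$; an interval $[i,j]$ is called unique/repeating according to $S[i..j]$. An interval $[i,j]$ is a minimal unique substring (MUS) of $S$ if $S[i..j]$ is unique and every proper substring $S[i'..j']$ with $i\le i'$, $j'\le j$, $j'-i'<j-i$ is repeating; $\mathcal{M}_S$ is the set of all MUS intervals of $S$. For intervals, $[s,t]\subset[i,j]$ means $i\le s$ and $t\le j$. For an interval $[s,t]$, an interval $[i,j]$ is a shortest unique substring (SUS) for $[s,t]$ if (1) $S[i..j]$ is unique, (2) $[s,t]\subset[i,j]$, and (3) $S[i'..j']$ is repeating for every $[i',j']$ with $[s,t]\subset[i',j']$ and $j'-i'<j-i$. $\mathsf{SUS}_S(p)$ denotes the set of SUSs for $[p,p]$, and $\mathcal{PS}_S=\bigcup_{p=1}^{n}\mathsf{SUS}_S(p)$ is the set of all point SUSs of $S$. -}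

module Defs where

open import Data.Nat using (ℕ; zero; suc; _+_; _∸_; _≤_; _<_)
open import Data.List using (List; []; _∷_)
open import Data.Maybe using (Maybe; just; nothing)
open import Data.Product using (_×_; ∃-syntax)
open import Relation.Nullary using (¬_)
open import Relation.Binary.PropositionalEquality using (_≡_)

-- Positions are 0-based: a string S of length n has positions 0 … n-1.
-- An interval is a pair (i , j) of naturals, denoting S[i..j].

at : ∀ {A : Set} → List A → ℕ → Maybe A
at []       _       = nothing
at (x ∷ xs) zero    = just x
at (x ∷ xs) (suc k) = at xs k

module _ {A : Set} (S : List A) where

  open import Data.List using (length)

  Valid : ℕ → ℕ → Set
  Valid i j = i ≤ j × j < length S

  OccAt : ℕ → ℕ → ℕ → Set
  OccAt k i j = k + (j ∸ i) < length S
              × (∀ d → d ≤ j ∸ i → at S (k + d) ≡ at S (i + d))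

  Unique : ℕ → ℕ → Set
  Unique i j = ∀ k → OccAt k i j → k ≡ i

  Repeating : ℕ → ℕ → Set
  Repeating i j = ∃[ k ] (¬ (k ≡ i) × OccAt k i j)

  IsMUS : ℕ → ℕ → Set
  IsMUS i j = Valid i j × Unique i j
            × (∀ i' j' → i' ≤ j' → i ≤ i' → j' ≤ j → j' ∸ i' < j ∸ i → Repeating i' j')

  IsSUS : ℕ → ℕ → ℕ → ℕ → Set
  IsSUS s t i j = Valid i j × Unique i j × (i ≤ s × t ≤ j)
                × (∀ i' j' → Valid i' j' → (i' ≤ s × t ≤ j') → j' ∸ i' < j ∸ i → Repeating i' j')

  IsPointSUS : ℕ → ℕ → Set
  IsPointSUS i j = ∃[ p ] (p < length S × IsSUS p p i j)

-- A duplicate-free list enumerating exactly the intervals satisfying P;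
-- its length is the cardinality of the set { [i,j] | P i j }.
open import Data.List.Relation.Unary.Unique.Propositional using () renaming (Unique to Distinct)
open import Data.List.Membership.Propositional using (_∈_)

Enumerates : (ℕ → ℕ → Set) → List (ℕ × ℕ) → Set
Enumerates P L = Distinct L × (∀ i j → ((i Data.Product., j) ∈ L → P i j) × (P i j → (i Data.Product., j) ∈ L))

-- Every point SUS [i,j] (a SUS for some position p) falls into one
-- of three kinds: if p = i it is "left-anchored" (a SUS for its start); if p is
-- strictly inside, both neighbours [i+1,j] and [i,j-1] still contain p, hence
-- are repeating, so [i,j] is a MUS; if p = j and [i,j] is not a MUS it is
-- "right-anchored" (a SUS for its end).  We code every point SUS by one
-- endpoint, inj₁ i for MUSs and left-anchored ones, inj₂ j for right-anchored
-- ones, and every MUS [s,t] by inj₂ t.  Comparing nested unique intervals shows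
-- these codes are injective on PS and on M, and that no right-anchored point
-- SUS (which is not a MUS) shares its end with a MUS.  All codes lie in
-- {0..n-1} ⊎ {0..n-1}, so |PS| + |M| ≤ n + n.

module Submission where

open import Defs

open import Data.Nat using (ℕ; suc; s≤s; _+_; _*_; _∸_; _≤_; _<_; _≟_; _<?_)
open import Data.Nat.Properties
open import Data.Fin using (Fin; join; splitAt; fromℕ<)
open import Data.Fin.Properties using (splitAt-join; join-splitAt; injective⇒≤; fromℕ<-injective)
open import Data.List using (List; _∷_; length; lookup)
open import Data.List.Membership.Propositional using (_∈_)
open import Data.List.Membership.Propositional.Properties using (∈-lookup)
open import Data.List.Relation.Unary.AllPairs using (_∷_)
import Data.List.Relation.Unary.All as All
open import Data.List.Relation.Unary.Unique.Propositional using () renaming (Unique to Distinct)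
open import Data.Product using (_×_; _,_; proj₁; proj₂)
open import Data.Product.Properties using (≡-dec)
open import Data.List.Membership.DecPropositional (≡-dec _≟_ _≟_) using (_∈?_)
open import Data.Sum using (_⊎_; inj₁; inj₂)
open import Data.Sum.Properties using (inj₁-injective; inj₂-injective)
open import Data.Empty using (⊥-elim)
open import Function using (_∘_)
open import Function.Definitions using (Injective)
open import Relation.Nullary using (¬_; Dec; yes; no; contradiction)
open import Relation.Nullary.Decidable using (map′)
open import Relation.Binary.PropositionalEquality

≮-antisym : ∀ {m n} → ¬ n < m → ¬ m < n → m ≡ n
≮-antisym n≮m m≮n = ≤-antisym (≮⇒≥ n≮m) (≮⇒≥ m≮n)

⊎-injection⇒≤ : ∀ {m n a b} (f : Fin m ⊎ Fin n → Fin a ⊎ Fin b) →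
                Injective _≡_ _≡_ f → m + n ≤ a + b
⊎-injection⇒≤ {m} {n} {a} {b} f f-inj = injective⇒≤ {f = join a b ∘ f ∘ splitAt m} inj
  where
  join-inj : ∀ {u v} → join a b u ≡ join a b v → u ≡ v
  join-inj {u} {v} e = trans (sym (splitAt-join a b u)) (trans (cong (splitAt a) e) (splitAt-join a b v))
  splitAt-inj : ∀ {x y} → splitAt m {n} x ≡ splitAt m y → x ≡ y
  splitAt-inj {x} {y} e = trans (sym (join-splitAt m n x)) (trans (cong (join m n) e) (join-splitAt m n y))
  inj : Injective _≡_ _≡_ (join a b ∘ f ∘ splitAt m)
  inj = splitAt-inj ∘ f-inj ∘ join-inj

lookup-injective : ∀ {X : Set} {L : List X} → Distinct L →
                   ∀ {k l} → lookup L k ≡ lookup L l → k ≡ l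
lookup-injective {L = x ∷ xs} (x∉ ∷ d) {Fin.zero}  {Fin.zero}  e = refl
lookup-injective {L = x ∷ xs} (x∉ ∷ d) {Fin.zero}  {Fin.suc l} e = ⊥-elim (All.lookup x∉ (∈-lookup {xs = xs} l) e)
lookup-injective {L = x ∷ xs} (x∉ ∷ d) {Fin.suc k} {Fin.zero}  e = ⊥-elim (All.lookup x∉ (∈-lookup {xs = xs} k) (sym e))
lookup-injective {L = x ∷ xs} (x∉ ∷ d) {Fin.suc k} {Fin.suc l} e = cong Fin.suc (lookup-injective d e)

Below : ℕ → ℕ ⊎ ℕ → Set
Below N (inj₁ a) = a < N
Below N (inj₂ b) = b < N

toFin : ∀ {N} (u : ℕ ⊎ ℕ) → Below N u → Fin N ⊎ Fin N
toFin (inj₁ a) a<N = inj₁ (fromℕ< a<N)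
toFin (inj₂ b) b<N = inj₂ (fromℕ< b<N)

toFin-injective : ∀ {N} u v (bu : Below N u) (bv : Below N v) → toFin u bu ≡ toFin v bv → u ≡ v
toFin-injective (inj₁ a) (inj₁ a') bu bv e = cong inj₁ (fromℕ<-injective a a' bu bv (inj₁-injective e))
toFin-injective (inj₂ b) (inj₂ b') bu bv e = cong inj₂ (fromℕ<-injective b b' bu bv (inj₂-injective e))
toFin-injective (inj₁ _) (inj₂ _)  _  _  ()
toFin-injective (inj₂ _) (inj₁ _)  _  _  ()

module TwoListCount {X Y : Set} (L₁ : List X) (L₂ : List Y) (N : ℕ)
  (distinct₁ : Distinct L₁) (distinct₂ : Distinct L₂)
  (c₁ : ∀ {x} → x ∈ L₁ → ℕ ⊎ ℕ) (c₂ : ∀ {y} → y ∈ L₂ → ℕ ⊎ ℕ)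
  (below₁ : ∀ {x} (p : x ∈ L₁) → Below N (c₁ p))
  (below₂ : ∀ {y} (q : y ∈ L₂) → Below N (c₂ q))
  (injective₁ : ∀ {x x'} (p : x ∈ L₁) (p' : x' ∈ L₁) → c₁ p ≡ c₁ p' → x ≡ x')
  (injective₂ : ∀ {y y'} (q : y ∈ L₂) (q' : y' ∈ L₂) → c₂ q ≡ c₂ q' → y ≡ y')
  (disjoint : ∀ {x y} (p : x ∈ L₁) (q : y ∈ L₂) → c₁ p ≢ c₂ q) where

  code : Fin (length L₁) ⊎ Fin (length L₂) → ℕ ⊎ ℕ
  code (inj₁ k) = c₁ (∈-lookup k)
  code (inj₂ l) = c₂ (∈-lookup l)

  code-below : ∀ u → Below N (code u)
  code-below (inj₁ k) = below₁ (∈-lookup k)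
  code-below (inj₂ l) = below₂ (∈-lookup l)

  code-injective : ∀ u v → code u ≡ code v → u ≡ v
  code-injective (inj₁ k) (inj₁ k') e = cong inj₁ (lookup-injective distinct₁ (injective₁ (∈-lookup k) (∈-lookup k') e))
  code-injective (inj₁ k) (inj₂ l)  e = contradiction e (disjoint (∈-lookup k) (∈-lookup l))
  code-injective (inj₂ l) (inj₁ k)  e = contradiction (sym e) (disjoint (∈-lookup k) (∈-lookup l))
  code-injective (inj₂ l) (inj₂ l') e = cong inj₂ (lookup-injective distinct₂ (injective₂ (∈-lookup l) (∈-lookup l') e))

  count : length L₁ + length L₂ ≤ N + N
  count = ⊎-injection⇒≤ (λ u → toFin (code u) (code-below u))
            (λ {u} {v} e → code-injective u v (toFin-injective (code u) (code v) (code-below u) (code-below v) e))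

enumerated⇒decidable : ∀ {P L} → Enumerates P L → ∀ i j → Dec (P i j)
enumerated⇒decidable (_ , enum) i j = map′ (proj₁ (enum i j)) (proj₂ (enum i j)) ((i , j) ∈? _)

module Intervals {A : Set} (S : List A) where

  unique⇒¬repeating : ∀ {i j} → Unique S i j → ¬ Repeating S i j
  unique⇒¬repeating u (k , k≢i , occ) = k≢i (u k occ)

  occ-shift : ∀ {k i j j'} a → i + a ≤ j' → j' ≤ j → OccAt S k i j → OccAt S (k + a) (i + a) j'
  occ-shift {k} {i} {j} {j'} a i+a≤j' j'≤j (in-range , agree) = in-range′ , agree′
    where
    a≤j'∸i : a ≤ j' ∸ i
    a≤j'∸i = m+n≤o⇒m≤o∸n a (subst (_≤ j') (+-comm i a) i+a≤j')
    width : a + (j' ∸ (i + a)) ≤ j ∸ i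
    width = begin
      a + (j' ∸ (i + a)) ≡⟨ cong (a +_) (sym (∸-+-assoc j' i a)) ⟩
      a + (j' ∸ i ∸ a)   ≡⟨ m+[n∸m]≡n a≤j'∸i ⟩
      j' ∸ i             ≤⟨ ∸-monoˡ-≤ i j'≤j ⟩
      j ∸ i              ∎
      where open ≤-Reasoning
    in-range′ : k + a + (j' ∸ (i + a)) < length S
    in-range′ = ≤-<-trans (≤-trans (≤-reflexive (+-assoc k a _)) (+-monoʳ-≤ k width)) in-range
    agree′ : ∀ d → d ≤ j' ∸ (i + a) → at S (k + a + d) ≡ at S (i + a + d)
    agree′ d d≤ = begin
      at S (k + a + d)   ≡⟨ cong (at S) (+-assoc k a d) ⟩
      at S (k + (a + d)) ≡⟨ agree (a + d) (≤-trans (+-monoʳ-≤ a d≤) width) ⟩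
      at S (i + (a + d)) ≡⟨ cong (at S) (sym (+-assoc i a d)) ⟩
      at S (i + a + d)   ∎
      where open ≡-Reasoning

  repeating-shrink : ∀ {i j i' j'} → i ≤ i' → i' ≤ j' → j' ≤ j → Repeating S i j → Repeating S i' j'
  repeating-shrink {i} {j} {i'} {j'} i≤i' i'≤j' j'≤j (k , k≢i , occ) =
      k + a , k+a≢i' , subst (λ x → OccAt S (k + a) x j') i+a≡i' shifted
    where
    a = i' ∸ i
    i+a≡i' : i + a ≡ i'
    i+a≡i' = m+[n∸m]≡n i≤i'
    shifted : OccAt S (k + a) (i + a) j'
    shifted = occ-shift a (subst (_≤ j') (sym i+a≡i') i'≤j') j'≤j occ
    k+a≢i' : k + a ≢ i'
    k+a≢i' e = k≢i (+-cancelʳ-≡ a k i (trans e (sym i+a≡i')))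

  mus-from-neighbours : ∀ {i j} → Valid S i (suc j) → Unique S i (suc j) →
                        Repeating S (suc i) (suc j) → Repeating S i j → IsMUS S i (suc j)
  mus-from-neighbours {i} {j} v u drop-first drop-last = v , u , minimal
    where
    minimal : ∀ i' j' → i' ≤ j' → i ≤ i' → j' ≤ suc j → j' ∸ i' < suc j ∸ i → Repeating S i' j'
    minimal i' j' i'≤j' i≤i' j'≤j shorter with j' <? suc j
    ... | yes j'<j = repeating-shrink i≤i' i'≤j' (≤-pred j'<j) drop-last
    ... | no j'≮j  = repeating-shrink i<i' i'≤j' j'≤j drop-first
      where
      i<i' : i < i'
      i<i' = ∸-cancelʳ-< (≤-<-trans (∸-monoˡ-≤ i' (≮⇒≥ j'≮j)) shorter)

  mus-minimal : ∀ {s t i' j'} → IsMUS S s t → i' ≤ j' → s ≤ i' → j' ≤ t → j' ∸ i' < t ∸ s →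
                ¬ Unique S i' j'
  mus-minimal (_ , _ , minimal) i'≤j' s≤i' j'≤t shorter u = unique⇒¬repeating u (minimal _ _ i'≤j' s≤i' j'≤t shorter)

  sus-minimal : ∀ {p i j i' j'} → IsSUS S p p i j → Valid S i' j' → i' ≤ p → p ≤ j' →
                j' ∸ i' < j ∸ i → ¬ Unique S i' j'
  sus-minimal (_ , _ , _ , shortest) v i'≤p p≤j' shorter u = unique⇒¬repeating u (shortest _ _ v (i'≤p , p≤j') shorter)

  -- A SUS for a point strictly inside it is a MUS: both neighbours still
  -- contain the point, so they are repeating by the SUS minimality.
  interior-sus-is-mus : ∀ {p i j} → IsSUS S p p i j → i < p → p < j → IsMUS S i j
  interior-sus-is-mus {p} {i} {suc j} ((i≤j+1 , j+1<n) , u , (i≤p , p≤j+1) , shortest) i<p (s≤s p≤j) =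
      mus-from-neighbours (i≤j+1 , j+1<n) u drop-first drop-last
    where
    i≤j : i ≤ j
    i≤j = ≤-trans i≤p p≤j
    drop-first : Repeating S (suc i) (suc j)
    drop-first = shortest (suc i) (suc j) (s≤s i≤j , j+1<n) (i<p , p≤j+1) (∸-monoʳ-< (n<1+n i) (s≤s i≤j))
    drop-last : Repeating S i j
    drop-last = shortest i j (i≤j , <-trans (n<1+n j) j+1<n) (i≤p , p≤j) (∸-monoˡ-< (n<1+n j) i≤j)

  mus-same-end : ∀ {s s' t} → IsMUS S s t → IsMUS S s' t → s ≡ s'
  mus-same-end m m' = ≮-antisym (inside m' m) (inside m m')
    where
    inside : ∀ {s s' t} → IsMUS S s t → IsMUS S s' t → ¬ s < s'
    inside m ((s'≤t , _) , u' , _) s<s' = mus-minimal m s'≤t (<⇒≤ s<s') ≤-refl (∸-monoʳ-< s<s' s'≤t) u'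

  mus-same-start : ∀ {s t t'} → IsMUS S s t → IsMUS S s t' → t ≡ t'
  mus-same-start m m' = ≮-antisym (inside m' m) (inside m m')
    where
    inside : ∀ {s t t'} → IsMUS S s t → IsMUS S s t' → ¬ t < t'
    inside ((s≤t , _) , u , _) m' t<t' = mus-minimal m' s≤t ≤-refl (<⇒≤ t<t') (∸-monoˡ-< t<t' s≤t) u

  right-sus-same-start : ∀ {i i' j} → IsSUS S j j i j → IsSUS S j j i' j → i ≡ i'
  right-sus-same-start sus sus' = ≮-antisym (inside sus' sus) (inside sus sus')
    where
    inside : ∀ {i i' j} → IsSUS S j j i j → IsSUS S j j i' j → ¬ i < i'
    inside sus (v'@(i'≤j , _) , u' , _) i<i' = sus-minimal sus v' i'≤j ≤-refl (∸-monoʳ-< i<i' i'≤j) u'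

  left-sus-same-end : ∀ {i j j'} → IsSUS S i i i j → IsSUS S i i i j' → j ≡ j'
  left-sus-same-end sus sus' = ≮-antisym (inside sus' sus) (inside sus sus')
    where
    inside : ∀ {i j j'} → IsSUS S i i i j → IsSUS S i i i j' → ¬ j < j'
    inside (v@(i≤j , _) , u , _) sus' j<j' = sus-minimal sus' v ≤-refl i≤j (∸-monoˡ-< j<j' i≤j) u

  right-sus-meets-mus : ∀ {i s j} → IsSUS S j j i j → IsMUS S s j → i ≡ s
  right-sus-meets-mus sus@((i≤j , _) , u , _) mus@(v@(s≤j , _) , u' , _) =
      ≮-antisym (λ s<i → mus-minimal mus i≤j (<⇒≤ s<i) ≤-refl (∸-monoʳ-< s<i i≤j) u)
                (λ i<s → sus-minimal sus v s≤j ≤-refl (∸-monoʳ-< i<s s≤j) u')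

  left-sus-meets-mus : ∀ {i j t} → IsSUS S i i i j → IsMUS S i t → j ≡ t
  left-sus-meets-mus sus@((i≤j , _) , u , _) mus@(v@(i≤t , _) , u' , _) =
      ≮-antisym (λ t<j → sus-minimal sus v ≤-refl i≤t (∸-monoˡ-< t<j i≤t) u')
                (λ j<t → mus-minimal mus i≤j ≤-refl (<⇒≤ j<t) (∸-monoˡ-< j<t i≤j) u)

  data Kind (i j : ℕ) : Set where
    minimal        : IsMUS S i j → Kind i j
    left-anchored  : IsSUS S i i i j → Kind i j
    right-anchored : IsSUS S j j i j → ¬ IsMUS S i j → Kind i j

  classify : ∀ {i j} → IsPointSUS S i j → Dec (IsMUS S i j) → Kind i j
  classify {i} {j} (p , _ , sus@(_ , _ , (i≤p , p≤j) , _)) mus? with p ≟ i | mus?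
  ... | yes refl | _     = left-anchored sus
  ... | no _     | yes m = minimal m
  ... | no p≢i   | no ¬m with p ≟ j
  ...   | yes refl = right-anchored sus ¬m
  ...   | no p≢j   = contradiction (interior-sus-is-mus sus i<p p<j) ¬m
    where
    i<p : i < p
    i<p = ≤∧≢⇒< i≤p (p≢i ∘ sym)
    p<j : p < j
    p<j = ≤∧≢⇒< p≤j p≢j

  code : ∀ {i j} → Kind i j → ℕ ⊎ ℕ
  code {i} (minimal _)             = inj₁ i
  code {i} (left-anchored _)       = inj₁ i
  code {j = j} (right-anchored _ _) = inj₂ j

  mus-code : ℕ × ℕ → ℕ ⊎ ℕ
  mus-code (s , t) = inj₂ t

  code-injective : ∀ {i j i' j'} (κ : Kind i j) (κ' : Kind i' j') → code κ ≡ code κ' → (i , j) ≡ (i' , j')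
  code-injective {i} (minimal m)         (minimal m')         refl = cong (i ,_) (mus-same-start m m')
  code-injective {i} (minimal m)         (left-anchored sus)  refl = cong (i ,_) (sym (left-sus-meets-mus sus m))
  code-injective {i} (left-anchored sus) (minimal m)          refl = cong (i ,_) (left-sus-meets-mus sus m)
  code-injective {i} (left-anchored sus) (left-anchored sus') refl = cong (i ,_) (left-sus-same-end sus sus')
  code-injective {j = j} (right-anchored sus _) (right-anchored sus' _) refl = cong (_, j) (right-sus-same-start sus sus')
  code-injective (minimal _)          (right-anchored _ _) ()
  code-injective (left-anchored _)    (right-anchored _ _) ()
  code-injective (right-anchored _ _) (minimal _)          ()
  code-injective (right-anchored _ _) (left-anchored _)    ()

  mus-code-injective : ∀ {s t s' t'} → IsMUS S s t → IsMUS S s' t' → mus-code (s , t) ≡ mus-code (s' , t') →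
                       (s , t) ≡ (s' , t')
  mus-code-injective {t = t} m m' refl = cong (_, t) (mus-same-end m m')

  -- A point SUS and a MUS never share a code: the only candidates are a
  -- right-anchored SUS and a MUS with the same end, which would coincide.
  codes-disjoint : ∀ {i j s t} (κ : Kind i j) → IsMUS S s t → code κ ≢ mus-code (s , t)
  codes-disjoint (minimal _)       _ ()
  codes-disjoint (left-anchored _) _ ()
  codes-disjoint {j = j} (right-anchored sus ¬m) m refl =
    ¬m (subst (λ x → IsMUS S x j) (sym (right-sus-meets-mus sus m)) m)

  start-below : ∀ {i j} → Valid S i j → i < length S
  start-below (i≤j , j<n) = ≤-<-trans i≤j j<n

  code-below : ∀ {i j} (κ : Kind i j) → Below (length S) (code κ)
  code-below (minimal (v , _))           = start-below v
  code-below (left-anchored (v , _))     = start-below v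
  code-below (right-anchored (v , _) _)  = proj₂ v

  mus-code-below : ∀ {s t} → IsMUS S s t → Below (length S) (mus-code (s , t))
  mus-code-below ((_ , t<n) , _) = t<n

theorem1 : {A : Set} (S : List A) (PS M : List (ℕ × ℕ))
    → Enumerates (IsPointSUS S) PS → Enumerates (IsMUS S) M
    → length PS ≤ 2 * length S ∸ length M
theorem1 S PS M (PS-distinct , PS-members) M-enum@(M-distinct , M-members) =
  m+n≤o⇒m≤o∸n (length PS) (subst (length PS + length M ≤_) (sym 2n≡n+n) count)
  where
  open Intervals S
  n : ℕ
  n = length S
  2n≡n+n : 2 * n ≡ n + n
  2n≡n+n = cong (n +_) (+-identityʳ n)
  kind : ∀ {x} → x ∈ PS → Kind (proj₁ x) (proj₂ x)
  kind {i , j} p = classify (proj₁ (PS-members i j) p) (enumerated⇒decidable M-enum i j)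
  mus : ∀ {x} → x ∈ M → IsMUS S (proj₁ x) (proj₂ x)
  mus {s , t} q = proj₁ (M-members s t) q
  open TwoListCount PS M n PS-distinct M-distinct (code ∘ kind) (λ {x} _ → mus-code x)
         (code-below ∘ kind) (mus-code-below ∘ mus)
         (λ p p' → code-injective (kind p) (kind p')) (λ q q' → mus-code-injective (mus q) (mus q'))
         (λ p q → codes-disjoint (kind p) (mus q))
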